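{- Let $U$ be an $n$-headed automaton and $V$ a finite automaton, both over a common finite alphabet $\Sigma$. Then there is an $n$-headed automaton $W$ over $\Sigma$ with $L(W)=L(U)\cap L(V)$.
   Context: A (nondeterministic) automaton is $(S,\Sigma,\delta,s_0,F)$ with states $S$, finite alphabet $\Sigma$, transitions $\delta\subseteq S\times(\Sigma\cup\{\varepsilon\})\times S$, initial state $s_0$ and final states $F$; it is finite if $S$ is finite, and its language is the set of words labelling paths from $s_0$ to a state in $F$. An $n$-headed (finite) automaton over $\Sigma$ is a finite automaton $(S,\{1,\dots,n\}\times\Sigma,\delta,s_0,F)$ over the alphabet $\{1,\dots,n\}\times\Sigma$. For $\sigma\in(\{1,\dots,n\}\times\Sigma)^*$ let $\sigma|_k\in\Sigma^*$ be obtained by keeping the letters $(k,a)$ and dropping the index $k$. The language of the $n$-headed automaton is $\{\sigma|_1\cdot\sigma|_2\cdots\sigma|_n : s_0\xrightarrow{\sigma}s\text{ for some }s\in F\}$. -}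

module Defs where

open import Data.Nat using (ℕ)
open import Data.Fin using (Fin; _≟_)
open import Data.Fin.Base using (Fin)
open import Data.List using (List; []; _∷_; concat; map; allFin)
open import Data.Maybe using (Maybe; just; nothing)
open import Data.Product using (_×_; _,_; Σ; ∃)
open import Relation.Binary.PropositionalEquality using (_≡_)
open import Relation.Nullary using (yes; no)

-- A finite (nondeterministic) automaton over alphabet A:
-- states are Fin states (finite), transitions labelled by letters
-- ('just a') or ε ('nothing'), an initial state and a set of final states.
record Automaton (A : Set) : Set₁ where
  field
    states  : ℕ
    δ       : Fin states → Maybe A → Fin states → Set
    initial : Fin states
    final   : Fin states → Set

module _ {A : Set} (M : Automaton A) where
  open Automaton M

  data Path : Fin states → List A → Fin states → Set where
    stay : ∀ {s} → Path s [] s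
    step : ∀ {s t u a w} → δ s (just a) t → Path t w u → Path s (a ∷ w) u
    εstep : ∀ {s t u w} → δ s nothing t → Path t w u → Path s w u

  Accepts : List A → Set
  Accepts w = Σ (Fin states) λ s → Path initial w s × final s

HeadedAutomaton : ℕ → ℕ → Set₁
HeadedAutomaton n m = Automaton (Fin n × Fin m)

restrict : ∀ {n m} → Fin n → List (Fin n × Fin m) → List (Fin m)
restrict k [] = []
restrict k ((j , a) ∷ σ) with j ≟ k
... | yes _ = a ∷ restrict k σ
... | no  _ = restrict k σ

headsConcat : ∀ {n m} → List (Fin n × Fin m) → List (Fin m)
headsConcat {n} σ = concat (map (λ k → restrict k σ) (allFin n))

HAccepts : ∀ {n m} → HeadedAutomaton n m → List (Fin m) → Set
HAccepts U w = Σ _ λ σ → Accepts U σ × (headsConcat σ ≡ w)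

-- W runs U and, alongside, one copy of V per head.  At the start W guesses
-- the V-state gᵢ at which the V-run on σ|ᵢ begins; head i then drives its
-- own V-state pᵢ forward on the letters it reads.  W accepts when U accepts
-- and the segments gᵢ ⟶ pᵢ can be glued by ε-paths into one accepting run
-- of V: initial ⟶ g₁, p₁ ⟶ g₂, …, pₙ ⟶ final.  The state space
-- 1 + |U| · |V|ⁿ · |V|ⁿ is finite.
module Submission where

open import Defs
open import Data.Nat using (ℕ; zero; suc; _+_; _*_; _^_)
open import Data.Fin using (Fin; zero; suc; _≟_)
open import Data.Fin.Base using (finToFun; funToFin)
open import Data.Fin.Properties using (+↔⊎; *↔×; 1↔⊤; finToFun-funToFin)
open import Data.List using (List; []; _∷_; _++_; concat; tabulate)
open import Data.List.Properties using (map-tabulate)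
open import Data.Vec using (Vec; []; _∷_; lookup; _[_]≔_) renaming (tabulate to tabulateᵛ)
open import Data.Vec.Properties
  using (lookup∘update; lookup∘update′; tabulate∘lookup; tabulate-cong)
open import Data.Maybe using (Maybe; just; nothing)
open import Data.Product using (Σ; ∃; ∃₂; _×_; _,_)
open import Data.Product.Function.NonDependent.Propositional using (_×-↩_)
open import Data.Sum using (_⊎_; inj₁; inj₂)
open import Data.Sum.Function.Propositional using (_⊎-↩_)
open import Data.Unit using (⊤; tt)
open import Data.Empty using (⊥-elim)
open import Function using (_∘_)
open import Function.Bundles using (_⇔_; mk⇔; _↩_; mk↩; LeftInverse; module Equivalence)
open import Function.Construct.Composition using (_↩-∘_)
open import Function.Construct.Identity using (↩-id)
open import Function.Properties.Inverse using (↔⇒↩)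
open import Relation.Nullary using (yes; no; ¬_)
open import Relation.Binary.PropositionalEquality
  using (_≡_; refl; sym; trans; cong; subst; subst₂)

data Run {A S : Set} (δ : S → Maybe A → S → Set) : S → List A → S → Set where
  stay  : ∀ {s} → Run δ s [] s
  step  : ∀ {s t u a w} → δ s (just a) t → Run δ t w u → Run δ s (a ∷ w) u
  εstep : ∀ {s t u w} → δ s nothing t → Run δ t w u → Run δ s w u

retract-× : ∀ {a b} {A B : Set} → Fin a ↩ A → Fin b ↩ B → Fin (a * b) ↩ (A × B)
retract-× rA rB = (rA ×-↩ rB) ↩-∘ ↔⇒↩ *↔×

retract-⊎ : ∀ {a b} {A B : Set} → Fin a ↩ A → Fin b ↩ B → Fin (a + b) ↩ (A ⊎ B)
retract-⊎ rA rB = (rA ⊎-↩ rB) ↩-∘ ↔⇒↩ +↔⊎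

retract-Vec : ∀ s n → Fin (s ^ n) ↩ Vec (Fin s) n
retract-Vec s n = mk↩ {to = tabulateᵛ ∘ finToFun} {from = funToFin ∘ lookup}
  λ { {xs} refl → trans (tabulate-cong (finToFun-funToFin (lookup xs))) (tabulate∘lookup xs) }

-- A retraction suffices: runs are carried to Fin N by encode and back by decode.
module FiniteStates {A S : Set} {N : ℕ} (enum : Fin N ↩ S)
  (δ : S → Maybe A → S → Set) (initial : S) (final : S → Set) where

  open LeftInverse enum renaming (to to decode; from to encode)

  automaton : Automaton A
  automaton = record
    { states  = N
    ; δ       = λ i l j → δ (decode i) l (decode j)
    ; initial = encode initial
    ; final   = final ∘ decode
    }

  path⇒run : ∀ {i w j} → Path automaton i w j → Run δ (decode i) w (decode j)
  path⇒run stay        = stay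
  path⇒run (step d p)  = step d (path⇒run p)
  path⇒run (εstep d p) = εstep d (path⇒run p)

  encode-δ : ∀ {s l t} → δ s l t → δ (decode (encode s)) l (decode (encode t))
  encode-δ {s} {l} {t} =
    subst₂ (λ s′ t′ → δ s′ l t′) (sym (strictlyInverseˡ s)) (sym (strictlyInverseˡ t))

  run⇒path : ∀ {s w t} → Run δ s w t → Path automaton (encode s) w (encode t)
  run⇒path stay        = stay
  run⇒path (step d r)  = step (encode-δ d) (run⇒path r)
  run⇒path (εstep d r) = εstep (encode-δ d) (run⇒path r)

  accepts⇔ : ∀ w → Accepts automaton w ⇔ (∃ λ s → Run δ initial w s × final s)
  accepts⇔ w = mk⇔
    (λ (j , p , f) →
      decode j , subst (λ s → Run δ s w (decode j)) (strictlyInverseˡ initial) (path⇒run p) , f)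
    (λ (s , r , f) → encode s , run⇒path r , subst final (sym (strictlyInverseˡ s)) f)

module Concatenation {B : Set} (V : Automaton B) where
  open Automaton V

  _⟶ε_ : Fin states → Fin states → Set
  q ⟶ε r = Path V q [] r

  _++ᵖ_ : ∀ {q xs r ys s} → Path V q xs r → Path V r ys s → Path V q (xs ++ ys) s
  stay      ++ᵖ p′ = p′
  step d p  ++ᵖ p′ = step d (p ++ᵖ p′)
  εstep d p ++ᵖ p′ = εstep d (p ++ᵖ p′)

  split-++ᵖ : ∀ xs {ys q s} → Path V q (xs ++ ys) s →
              ∃ λ r → Path V q xs r × Path V r ys s
  split-++ᵖ []       {q = q} p = q , stay , p
  split-++ᵖ (x ∷ xs) (step d p) with r , p₁ , p₂ ← split-++ᵖ xs p = r , step d p₁ , p₂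
  split-++ᵖ (x ∷ xs) (εstep d p) with r , p₁ , p₂ ← split-++ᵖ (x ∷ xs) p = r , εstep d p₁ , p₂

  -- Segment i runs from gᵢ to eᵢ; `Links q g e` holds the ε-paths
  -- q ⟶ g₀, eᵢ ⟶ gᵢ₊₁ and e_last ⟶ final gluing the segments together.
  Links : ∀ {k} → Fin states → Vec (Fin states) k → Vec (Fin states) k → Set
  Links q []       []       = ∃ λ f → q ⟶ε f × final f
  Links q (g ∷ gs) (e ∷ es) = q ⟶ε g × Links e gs es

  Segments : ∀ {k} → (Fin k → List B) → Vec (Fin states) k → Vec (Fin states) k → Set
  Segments h g e = ∀ i → Path V (lookup g i) (h i) (lookup e i)

  links-ε-start : ∀ {k q′ q} {g e : Vec _ k} → q′ ⟶ε q → Links q g e → Links q′ g e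
  links-ε-start {g = []}    {[]}    ε (f , ε′ , ff) = f , ε ++ᵖ ε′ , ff
  links-ε-start {g = _ ∷ _} {_ ∷ _} ε (ε′ , ls)     = ε ++ᵖ ε′ , ls

  links-ε-ends : ∀ {k q} {g e e′ : Vec _ k} → (∀ i → lookup e′ i ⟶ε lookup e i) →
                 Links q g e → Links q g e′
  links-ε-ends {g = []}    {[]}    {[]}    ε ls        = ls
  links-ε-ends {g = _ ∷ _} {_ ∷ _} {_ ∷ _} ε (ε₀ , ls) =
    ε₀ , links-ε-start (ε zero) (links-ε-ends (ε ∘ suc) ls)

  join-segments : ∀ {k} (h : Fin k → List B) {q} {g e : Vec _ k} →
                  Segments h g e → Links q g e →
                  ∃ λ f → Path V q (concat (tabulate h)) f × final f
  join-segments h {g = []}    {[]}    ps ls        = ls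
  join-segments h {g = _ ∷ _} {_ ∷ _} ps (ε₀ , ls)
    with f , p , ff ← join-segments (h ∘ suc) (ps ∘ suc) ls =
    f , ε₀ ++ᵖ (ps zero ++ᵖ p) , ff

  split-segments : ∀ {k} (h : Fin k → List B) {q f} →
                   Path V q (concat (tabulate h)) f → final f →
                   ∃₂ λ (g e : Vec _ k) → Segments h g e × Links q g e
  split-segments {zero}  h {f = f} p ff = [] , [] , (λ ()) , (f , p , ff)
  split-segments {suc k} h {q} p ff
    with r , p₀ , p′ ← split-++ᵖ (h zero) p
    with gs , es , ps , ls ← split-segments (h ∘ suc) p′ ff =
    q ∷ gs , r ∷ es , (λ { zero → p₀ ; (suc i) → ps i }) , stay , ls

restrict-≡ : ∀ {n m} (j : Fin n) (a : Fin m) σ → restrict j ((j , a) ∷ σ) ≡ a ∷ restrict j σ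
restrict-≡ j a σ with j ≟ j
... | yes _  = refl
... | no j≢j = ⊥-elim (j≢j refl)

restrict-≢ : ∀ {n m} {j k : Fin n} (a : Fin m) σ → ¬ j ≡ k →
             restrict k ((j , a) ∷ σ) ≡ restrict k σ
restrict-≢ {j = j} {k} a σ j≢k with j ≟ k
... | yes j≡k = ⊥-elim (j≢k j≡k)
... | no _    = refl

headsConcat-tabulate : ∀ {n m} (σ : List (Fin n × Fin m)) →
                       headsConcat σ ≡ concat (tabulate (λ k → restrict k σ))
headsConcat-tabulate σ = cong concat (map-tabulate (λ k → k) (λ k → restrict k σ))

module Intersection {n m : ℕ} (U : HeadedAutomaton n m) (V : Automaton (Fin m)) where
  open Concatenation V
  module U = Automaton U
  module V = Automaton V

  Heads : Set
  Heads = Vec (Fin V.states) n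

  -- A configuration (u , g , p): U's state, the guessed V-state at which each
  -- head's segment starts, and the V-state each head has reached so far.
  State : Set
  State = ⊤ ⊎ Fin U.states × Heads × Heads

  -- A head takes V's ε-moves together with its next letter; those after its
  -- last letter are absorbed into Links (see links-ε-ends).
  data Step : State → Maybe (Fin n × Fin m) → State → Set where
    guess  : ∀ g → Step (inj₁ tt) nothing (inj₂ (U.initial , g , g))
    silent : ∀ {u u′ g p} → U.δ u nothing u′ →
             Step (inj₂ (u , g , p)) nothing (inj₂ (u′ , g , p))
    read   : ∀ {u u′ g p j a x} → U.δ u (just (j , a)) u′ → Path V (lookup p j) (a ∷ []) x →
             Step (inj₂ (u , g , p)) (just (j , a)) (inj₂ (u′ , g , p [ j ]≔ x))

  data Accepting : State → Set where
    accepting : ∀ {u g p} → U.final u → Links V.initial g p → Accepting (inj₂ (u , g , p))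

  enumeration : Fin (1 + U.states * (V.states ^ n * V.states ^ n)) ↩ State
  enumeration = retract-⊎ (↔⇒↩ 1↔⊤)
    (retract-× (↩-id _)
      (retract-× (retract-Vec V.states n) (retract-Vec V.states n)))

  open FiniteStates enumeration Step (inj₁ tt) Accepting

  intersection : HeadedAutomaton n m
  intersection = automaton

  HeadSegments : List (Fin n × Fin m) → Heads → Heads → Set
  HeadSegments σ = Segments (λ k → restrict k σ)

  segments-read : ∀ {j a σ x} (p e : Heads) → Path V (lookup p j) (a ∷ []) x →
                  HeadSegments σ (p [ j ]≔ x) e → HeadSegments ((j , a) ∷ σ) p e
  segments-read {j} {a} {σ} {x} p e px ps k with k ≟ j
  ... | yes refl = subst (λ w → Path V _ w _) (sym (restrict-≡ j a σ))
                     (px ++ᵖ subst (λ s → Path V s _ _) (lookup∘update j p x) (ps j))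
  ... | no k≢j   = subst₂ (λ s w → Path V s w _) (lookup∘update′ k≢j p x)
                     (sym (restrict-≢ a σ (k≢j ∘ sym))) (ps k)

  segments-unread : ∀ {j a σ} (p e : Heads) → HeadSegments ((j , a) ∷ σ) p e →
                    ∃ λ x → Path V (lookup p j) (a ∷ []) x × HeadSegments σ (p [ j ]≔ x) e
  segments-unread {j} {a} {σ} p e ps
    with x , px , pj ← split-++ᵖ (a ∷ []) (subst (λ w → Path V _ w _) (restrict-≡ j a σ) (ps j)) =
    x , px , ps′
    where
    ps′ : HeadSegments σ (p [ j ]≔ x) e
    ps′ k with k ≟ j
    ... | yes refl = subst (λ s → Path V s _ _) (sym (lookup∘update j p x)) pj
    ... | no k≢j   = subst₂ (λ s w → Path V s w _) (sym (lookup∘update′ k≢j p x))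
                       (restrict-≢ a σ (k≢j ∘ sym)) (ps k)

  run-sound : ∀ {u g p σ u′ g′ p′} → Run Step (inj₂ (u , g , p)) σ (inj₂ (u′ , g′ , p′)) →
              g′ ≡ g × Path U u σ u′ × HeadSegments σ p p′
  run-sound stay = refl , stay , λ _ → stay
  run-sound {p = p} {p′ = p′} (step (read du px) r) with refl , pu , ps ← run-sound r =
    refl , step du pu , segments-read p p′ px ps
  run-sound (εstep (silent du) r) with refl , pu , ps ← run-sound r =
    refl , εstep du pu , ps

  run-complete : ∀ {u g σ u′} (p e : Heads) → Path U u σ u′ → HeadSegments σ p e →
                 ∃ λ p′ → Run Step (inj₂ (u , g , p)) σ (inj₂ (u′ , g , p′)) ×
                          (∀ k → lookup p′ k ⟶ε lookup e k)
  run-complete p e stay ps = p , stay , ps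
  run-complete p e (εstep du pu) ps with p′ , r , ε ← run-complete p e pu ps =
    p′ , εstep (silent du) r , ε
  run-complete p e (step du pu) ps
    with x , px , ps′ ← segments-unread p e ps
    with p′ , r , ε ← run-complete _ e pu ps′ =
    p′ , step (read du px) r , ε

  accepts-intersection : ∀ σ → Accepts intersection σ ⇔ (Accepts U σ × Accepts V (headsConcat σ))
  accepts-intersection σ = mk⇔ (sound ∘ Equivalence.to (accepts⇔ σ))
                               (Equivalence.from (accepts⇔ σ) ∘ complete)
    where
    sound : (∃ λ s → Run Step (inj₁ tt) σ s × Accepting s) →
            Accepts U σ × Accepts V (headsConcat σ)
    sound (_ , εstep (guess g) r , accepting fu ls) with refl , pu , ps ← run-sound r =
      (_ , pu , fu) ,
      subst (Accepts V) (sym (headsConcat-tabulate σ)) (join-segments _ ps ls)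

    complete : Accepts U σ × Accepts V (headsConcat σ) →
               ∃ λ s → Run Step (inj₁ tt) σ s × Accepting s
    complete ((_ , pu , fu) , (_ , pv , fv))
      with g , e , ps , ls ←
             split-segments _ (subst (λ w → Path V _ w _) (headsConcat-tabulate σ) pv) fv
      with p′ , r , ε ← run-complete g e pu ps =
      _ , εstep (guess g) r , accepting fu (links-ε-ends ε ls)

lemma4 : (n m : ℕ) (U : HeadedAutomaton n m) (V : Automaton (Fin m)) →
    Σ (HeadedAutomaton n m) λ W →
      (w : List (Fin m)) → HAccepts W w ⇔ (HAccepts U w × Accepts V w)
lemma4 n m U V = intersection , λ w → mk⇔
  (λ (σ , acc , eq) → let (accU , accV) = to (accepts-intersection σ) acc in
    (σ , accU , eq) , subst (Accepts V) eq accV)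
  (λ ((σ , accU , eq) , accV) →
    σ , from (accepts-intersection σ) (accU , subst (Accepts V) (sym eq) accV) , eq)
  where
  open Intersection U V
  open Equivalence
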